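{- Let $(\mathbb{L},\mathbb{U})$ be a signature, fix $X\in\mathbb{U}$, and for $\varphi\in\mathcal{L}(\mathbb{L},\mathbb{U})$ define $\Box\varphi := \neg(\neg\varphi\succeq_X\neg\varphi)$ and $\Diamond\varphi := (\varphi\succeq_X\varphi)$. Then for all formulas $\varphi$, all models $\mathcal{M}=\langle D,\mathbb{W},t,u,s\rangle$ and all assignments $d$: (1) $[\Box\varphi]^{d}_{\mathcal{M}}\neq\emptyset$ iff $[\Box\varphi]^{d}_{\mathcal{M}}=\mathbb{W}$ iff $[\varphi]^{d}_{\mathcal{M}}=\mathbb{W}$; (2) $[\Diamond\varphi]^{d}_{\mathcal{M}}\neq\emptyset$ iff $[\Diamond\varphi]^{d}_{\mathcal{M}}=\mathbb{W}$ iff $[\varphi]^{d}_{\mathcal{M}}\neq\emptyset$.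
   Context: A signature is a pair $(\mathbb{L},\mathbb{U})$ where $\mathbb{L}$ is a collection of predicate and function symbols of various arities and $\mathbb{U}$ is a nonempty collection of nonempty subsets of $\mathbb{N}$. The language $\mathcal{L}(\mathbb{L},\mathbb{U})$ consists of the formulas of first-order logic over $\mathbb{L}$ with identity, built with $\neg,\wedge,\exists$ and variables $v_0,v_1,\dots$, closed additionally under: if $\varphi,\psi$ are formulas and $X\in\mathbb{U}$ then $(\varphi\succeq_X\psi)$ is a formula. A model is $\mathcal{M}=\langle D,\mathbb{W},t,u,s\rangle$ where $D$ is a nonempty domain, $\mathbb{W}$ a nonempty set of worlds, $t$ assigns to each world $w$ and each symbol of $\mathbb{L}$ an interpretation over $D$ of the appropriate arity ($=$ is interpreted as identity), $u:\mathbb{U}\times\mathbb{W}\to\mathbb{R}$ (written $u_X(w)$), and $s$ assigns to each $w\in\mathbb{W}$ and nonempty $A\subseteq\mathbb{W}$ an element $s(w,A)\in A$. An assignment $d$ maps variables to $D$ (extended to terms as usual). The proposition $[\varphi]^{d}_{\mathcal{M}}\subseteq\mathbb{W}$ is defined by: atomic $Pt_1\dots t_n$ gives $\{w: \langle d(t_1),\dots,d(t_n)\rangle\in t(w,P)\}$; $\neg$ is complement in $\mathbb{W}$; $\wedge$ is intersection; $[\exists x\psi]^d_{\mathcal{M}}$ is the set of $w$ with $w\in[\psi]^{d'}_{\mathcal{M}}$ for some $x$-variant $d'$ of $d$; $[\theta\succeq_X\psi]^d_{\mathcal{M}}=\emptyset$ if $[\theta]^d_{\mathcal{M}}$ or $[\psi]^d_{\mathcal{M}}$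 is empty, and otherwise equals $\{w\in\mathbb{W}: u_X(s(w,[\theta]^d_{\mathcal{M}}))\ge u_X(s(w,[\psi]^d_{\mathcal{M}}))\}$. -}

module Defs where

open import Level using (0ℓ)
open import Data.Nat using (ℕ; _≡ᵇ_)
open import Data.Bool using (if_then_else_)
open import Data.Vec using (Vec; []; _∷_)
open import Data.Product using (Σ; ∃; _×_; _,_)
open import Relation.Nullary using (¬_)
open import Relation.Binary.PropositionalEquality using (_≡_)
open import Relation.Binary.Bundles using (TotalOrder)
open import Function.Bundles using (_⇔_)

record Signature : Set₁ where
  field
    PredSym  : Set
    predArity : PredSym → ℕ
    FunSym   : Set
    funArity : FunSym → ℕ
    -- 𝕌 : a nonempty collection of nonempty subsets of ℕ,
    -- given by an index type of its members and their underlying subsets.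
    U        : Set
    subset   : U → ℕ → Set
    U-nonempty : U
    subset-nonempty : (X : U) → ∃ λ n → subset X n

module _ (Sg : Signature) where
  open Signature Sg

  data Term : Set where
    var : ℕ → Term
    app : (f : FunSym) → Vec Term (funArity f) → Term

  data Formula : Set where
    atom : (P : PredSym) → Vec Term (predArity P) → Formula
    _≐_  : Term → Term → Formula
    ¬'_  : Formula → Formula
    _∧'_ : Formula → Formula → Formula
    ∃'   : ℕ → Formula → Formula
    pref : U → Formula → Formula → Formula

  □[_]_ : U → Formula → Formula
  □[ X ] φ = ¬' pref X (¬' φ) (¬' φ)

  ◇[_]_ : U → Formula → Formula
  ◇[ X ] φ = pref X φ φ

  -- Models ⟨D, 𝕎, t, u, s⟩; utilities take values in the carrier of a
  -- total order R (standing in for ℝ with ≤).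
  record Model (R : TotalOrder 0ℓ 0ℓ 0ℓ) : Set₁ where
    open TotalOrder R renaming (Carrier to Val)
    field
      D   : Set
      d₀  : D
      W   : Set
      w₀  : W
      tP  : W → (P : PredSym) → Vec D (predArity P) → Set
      tF  : W → (f : FunSym) → Vec D (funArity f) → D
      u   : U → W → Val
      s   : W → (A : W → Set) → ∃ A → W
      s∈  : ∀ (w : W) (A : W → Set) (ne : ∃ A) → A (s w A ne)
      -- s depends only on the set A (extensionally), not on the predicate
      -- presentation or on the nonemptiness witness
      s-ext : ∀ (w : W) (A B : W → Set) (ne : ∃ A) (ne' : ∃ B) →
              (∀ v → (A v → B v) × (B v → A v)) → s w A ne ≡ s w B ne'

  module _ {R : TotalOrder 0ℓ 0ℓ 0ℓ} (M : Model R) where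
    open Model M
    open TotalOrder R using (_≤_)

    Assignment : Set
    Assignment = ℕ → D

    _[_↦_] : Assignment → ℕ → D → Assignment
    (d [ x ↦ a ]) y = if y ≡ᵇ x then a else d y

    evalT  : W → Assignment → Term → D
    evalTs : ∀ {n} → W → Assignment → Vec Term n → Vec D n
    evalT w d (var n) = d n
    evalT w d (app f ts) = tF w f (evalTs w d ts)
    evalTs w d [] = []
    evalTs w d (t ∷ ts) = evalT w d t ∷ evalTs w d ts

    ⟦_⟧ : Formula → Assignment → W → Set
    ⟦ atom P ts ⟧ d w = tP w P (evalTs w d ts)
    ⟦ t₁ ≐ t₂ ⟧ d w = evalT w d t₁ ≡ evalT w d t₂
    ⟦ ¬' φ ⟧ d w = ¬ ⟦ φ ⟧ d w
    ⟦ φ ∧' ψ ⟧ d w = ⟦ φ ⟧ d w × ⟦ ψ ⟧ d w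
    ⟦ ∃' x φ ⟧ d w = ∃ λ a → ⟦ φ ⟧ (d [ x ↦ a ]) w
    ⟦ pref X θ ψ ⟧ d w =
      Σ (∃ (⟦ θ ⟧ d)) λ neθ → Σ (∃ (⟦ ψ ⟧ d)) λ neψ →
        u X (s w (⟦ ψ ⟧ d) neψ) ≤ u X (s w (⟦ θ ⟧ d) neθ)

    IsEmpty : (W → Set) → Set
    IsEmpty A = ∀ w → ¬ A w

    IsAll : (W → Set) → Set
    IsAll A = ∀ w → A w

module Submission where

-- The key observation is that (ψ ⪰_X ψ) holds at a world w exactly when
-- [ψ] is nonempty: both selections s(w,[ψ]) coincide, so the utility
-- comparison is reflexive.  Hence the truth value of ◇ψ, and of its negated
-- form □φ = ¬◇¬φ, does not depend on the world.

open import Defs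
open import Level using (0ℓ)
open import Data.Product using (_×_; ∃; _,_; proj₁)
open import Data.Nat using (ℕ)
open import Relation.Nullary using (¬_)
open import Relation.Nullary.Negation using (∃⟶¬∀¬; ¬∃⟶∀¬; ∀⟶¬∃¬)
open import Relation.Binary.Bundles using (TotalOrder)
open import Function.Bundles using (_⇔_; mk⇔; Equivalence)
open Equivalence using (to; from)
open import Function.Construct.Composition using (_⇔-∘_)
open import Function.Related.TypeIsomorphisms using (¬-cong-⇔)
open import Axiom.ExcludedMiddle using (ExcludedMiddle)
open import Axiom.DoubleNegationElimination using (em⇒dne)

module WorldIndependent {W : Set} (w₀ : W) (A : W → Set) (P : Set)
                        (A⇔P : ∀ w → A w ⇔ P) where

  all⇔ : (∀ w → A w) ⇔ P
  all⇔ = mk⇔ (λ all → to (A⇔P w₀) (all w₀))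
             (λ p w → from (A⇔P w) p)

  -- Classically, A is either empty or everything: a nonempty extension is
  -- the whole set of worlds.  Excluded middle turns ¬¬P into P.
  nonempty⇔all : ExcludedMiddle 0ℓ → (¬ (∀ w → ¬ A w)) ⇔ (∀ w → A w)
  nonempty⇔all em = mk⇔ nonempty⇒all all⇒nonempty
    where
    nonempty⇒all : ¬ (∀ w → ¬ A w) → ∀ w → A w
    nonempty⇒all ne = from all⇔
      (em⇒dne em (λ ¬p → ne (λ w a → ¬p (to (A⇔P w) a))))

    all⇒nonempty : (∀ w → A w) → ¬ (∀ w → ¬ A w)
    all⇒nonempty all empty = empty w₀ (all w₀)

∃⇔¬∀¬ : ExcludedMiddle 0ℓ → {W : Set} (A : W → Set) →
        ∃ A ⇔ (¬ (∀ w → ¬ A w))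
∃⇔¬∀¬ em A = mk⇔ ∃⟶¬∀¬ (λ h → em⇒dne em (λ ¬∃ → h (¬∃⟶∀¬ ¬∃)))

¬∃¬⇔∀ : ExcludedMiddle 0ℓ → {W : Set} (A : W → Set) →
        (¬ ∃ λ w → ¬ A w) ⇔ (∀ w → A w)
¬∃¬⇔∀ em A = mk⇔ (λ h w → em⇒dne em (λ ¬a → h (w , ¬a))) ∀⟶¬∃¬

module _ (Sg : Signature) {R : TotalOrder 0ℓ 0ℓ 0ℓ} (M : Model Sg R)
         (X : Signature.U Sg) where
  open Model M using (W)

  -- ◇ψ holds at a world iff [ψ] is nonempty: given a witness, both sides of
  -- ψ ⪰_X ψ select the same world, and ≤ is reflexive.
  ◇-semantics : (ψ : Formula Sg) (d : ℕ → Model.D M) (w : W) →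
                ⟦_⟧ Sg M (◇[_]_ Sg X ψ) d w ⇔ ∃ (⟦_⟧ Sg M ψ d)
  ◇-semantics ψ d w = mk⇔ proj₁ (λ ne → ne , ne , TotalOrder.refl R)

  □-semantics : (φ : Formula Sg) (d : ℕ → Model.D M) (w : W) →
                ⟦_⟧ Sg M (□[_]_ Sg X φ) d w ⇔ (¬ ∃ λ v → ¬ ⟦_⟧ Sg M φ d v)
  □-semantics φ d w = ¬-cong-⇔ (◇-semantics (¬' φ) d w)

proposition7 : ExcludedMiddle 0ℓ →
    (Sg : Signature) (R : TotalOrder 0ℓ 0ℓ 0ℓ) (X : Signature.U Sg)
    (φ : Formula Sg) (M : Model Sg R) (d : ℕ → Model.D M) →
    (((¬ IsEmpty Sg M (⟦_⟧ Sg M (□[_]_ Sg X φ) d)) ⇔ IsAll Sg M (⟦_⟧ Sg M (□[_]_ Sg X φ) d))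
    × (IsAll Sg M (⟦_⟧ Sg M (□[_]_ Sg X φ) d) ⇔ IsAll Sg M (⟦_⟧ Sg M φ d)))
    × (((¬ IsEmpty Sg M (⟦_⟧ Sg M (◇[_]_ Sg X φ) d)) ⇔ IsAll Sg M (⟦_⟧ Sg M (◇[_]_ Sg X φ) d))
    × (IsAll Sg M (⟦_⟧ Sg M (◇[_]_ Sg X φ) d) ⇔ (¬ IsEmpty Sg M (⟦_⟧ Sg M φ d))))
proposition7 em Sg R X φ M d =
    (□.nonempty⇔all em , ¬∃¬⇔∀ em [φ] ⇔-∘ □.all⇔)
  , (◇.nonempty⇔all em , ∃⇔¬∀¬ em [φ] ⇔-∘ ◇.all⇔)
  where
  open Model M using (W; w₀)
  [φ] : W → Set
  [φ] = ⟦_⟧ Sg M φ d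
  module □ = WorldIndependent w₀ (⟦_⟧ Sg M (□[_]_ Sg X φ) d)
                              (¬ ∃ λ v → ¬ [φ] v)
                              (□-semantics Sg M X φ d)
  module ◇ = WorldIndependent w₀ (⟦_⟧ Sg M (◇[_]_ Sg X φ) d) (∃ [φ])
                              (◇-semantics Sg M X φ d)
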